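{- Suppose the predicates of LLFP (defined in the context) are closed under signature/context weakening and permutation and under substitution. If $\Gamma, x:\sigma, \Gamma'\vdash_\Sigma\alpha$ and $\Gamma\vdash_\Sigma N:\sigma$, then $\Gamma,\Gamma'[N/x]\vdash_\Sigma\alpha[N/x]$, where $\alpha$ ranges over the right-hand sides of LLFP judgements ($K$, $\sigma:K$, or $M:\sigma$).
   Context: LLFP (Lax Logical Framework) is parametrized by a set of predicates $\mathcal{P}$ on typing judgements $\Gamma \vdash_\Sigma N:\sigma$. Pseudo-syntax: signatures $\Sigma ::= \emptyset \mid \Sigma, a:K \mid \Sigma, c:\sigma$; contexts $\Gamma ::= \emptyset \mid \Gamma, x:\sigma$; kinds $K ::= \mathrm{Type} \mid \Pi x{:}\sigma.K$; families $\sigma,\tau,\rho ::= a \mid \Pi x{:}\sigma.\tau \mid \sigma N \mid \mathcal{L}^{\mathcal{P}}_{N,\sigma}[\rho]$; objects $M,N ::= c \mid x \mid \lambda x{:}\sigma.M \mid M N \mid \mathcal{L}^{\mathcal{P}}_{N,\sigma}[M] \mid \mathcal{U}^{\mathcal{P}}_{N,\sigma}[M]$. One-step $\beta\mathcal{L}$-reduction $\to_{\beta\mathcal{L}}$ is the closure under all constructors of $(\lambda x{:}\sigma.M)N \to M[N/x]$ and $\mathcal{U}^{\mathcal{P}}_{N,\sigma}[\mathcal{L}^{\mathcal{P}}_{N,\sigma}[M]] \to M$; $=_{\beta\mathcal{L}}$ is its reflexive, symmetric, transitive closure. Judgements: $\Sigma\ \mathrm{sig}$, $\vdash_\Sigma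 \Gamma$, $\Gamma\vdash_\Sigma K$, $\Gamma\vdash_\Sigma \sigma:K$, $\Gamma\vdash_\Sigma M:\sigma$, derived by the rules: Signatures: $\emptyset\ \mathrm{sig}$; from $\vdash_\Sigma K$ and $a\notin\mathrm{Dom}(\Sigma)$ infer $\Sigma,a:K\ \mathrm{sig}$; from $\vdash_\Sigma\sigma:\mathrm{Type}$ and $c\notin\mathrm{Dom}(\Sigma)$ infer $\Sigma,c:\sigma\ \mathrm{sig}$. Contexts: from $\Sigma\ \mathrm{sig}$ infer $\vdash_\Sigma\emptyset$; from $\Gamma\vdash_\Sigma\sigma:\mathrm{Type}$ and $x\notin\mathrm{Dom}(\Gamma)$ infer $\vdash_\Sigma\Gamma,x:\sigma$. Kinds: from $\vdash_\Sigma\Gamma$ infer $\Gamma\vdash_\Sigma\mathrm{Type}$; from $\Gamma,x:\sigma\vdash_\Sigma K$ infer $\Gamma\vdash_\Sigma\Pi x{:}\sigma.K$. Families: from $\vdash_\Sigma\Gamma$, $a:K\in\Sigma$ infer $\Gamma\vdash_\Sigma a:K$; from $\Gamma,x:\sigma\vdash_\Sigma\tau:\mathrm{Type}$ infer $\Gamma\vdash_\Sigma\Pi x{:}\sigma.\tau:\mathrm{Type}$; from $\Gamma\vdash_\Sigma\sigma:\Pi x{:}\tau.K$ and $\Gamma\vdash_\Sigma N:\tau$ infer $\Gamma\vdash_\Sigma\sigma N:K[N/x]$; from $\Gamma\vdash_\Sigma\rho:\mathrm{Type}$ and $\Gamma\vdash_\Sigma N:\sigma$ infer $\Gamma\vdash_\Sigma\mathcal{L}^{\mathcal{P}}_{N,\sigma}[\rho]:\mathrm{Type}$;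 from $\Gamma\vdash_\Sigma\sigma:K$, $\Gamma\vdash_\Sigma K'$, $K=_{\beta\mathcal{L}}K'$ infer $\Gamma\vdash_\Sigma\sigma:K'$; (F-Guarded-Unlock) from $\Gamma,x:\tau\vdash_\Sigma\mathcal{L}^{\mathcal{P}}_{S,\sigma}[\rho]:\mathrm{Type}$, $\Gamma\vdash_\Sigma N:\mathcal{L}^{\mathcal{P}}_{S',\sigma'}[\tau]$, $\sigma=_{\beta\mathcal{L}}\sigma'$, $S=_{\beta\mathcal{L}}S'$ infer $\Gamma\vdash_\Sigma\mathcal{L}^{\mathcal{P}}_{S,\sigma}[\rho[\mathcal{U}^{\mathcal{P}}_{S',\sigma'}[N]/x]]:\mathrm{Type}$. Objects: from $\vdash_\Sigma\Gamma$, $c:\sigma\in\Sigma$ infer $\Gamma\vdash_\Sigma c:\sigma$; from $\vdash_\Sigma\Gamma$, $x:\sigma\in\Gamma$ infer $\Gamma\vdash_\Sigma x:\sigma$; from $\Gamma,x:\sigma\vdash_\Sigma M:\tau$ infer $\Gamma\vdash_\Sigma\lambda x{:}\sigma.M:\Pi x{:}\sigma.\tau$; from $\Gamma\vdash_\Sigma M:\Pi x{:}\sigma.\tau$ and $\Gamma\vdash_\Sigma N:\sigma$ infer $\Gamma\vdash_\Sigma MN:\tau[N/x]$; from $\Gamma\vdash_\Sigma M:\sigma$, $\Gamma\vdash_\Sigma\tau:\mathrm{Type}$, $\sigma=_{\beta\mathcal{L}}\tau$ infer $\Gamma\vdash_\Sigma M:\tau$; (O-Lock) from $\Gamma\vdash_\Sigma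 M:\rho$ and $\Gamma\vdash_\Sigma N:\sigma$ infer $\Gamma\vdash_\Sigma\mathcal{L}^{\mathcal{P}}_{N,\sigma}[M]:\mathcal{L}^{\mathcal{P}}_{N,\sigma}[\rho]$; (O-Top-Unlock) from $\Gamma\vdash_\Sigma M:\mathcal{L}^{\mathcal{P}}_{N,\sigma}[\rho]$ and the (externally decided) fact that $\mathcal{P}(\Gamma\vdash_\Sigma N:\sigma)$ holds, infer $\Gamma\vdash_\Sigma\mathcal{U}^{\mathcal{P}}_{N,\sigma}[M]:\rho$; (O-Guarded-Unlock) from $\Gamma,x:\tau\vdash_\Sigma\mathcal{L}^{\mathcal{P}}_{S,\sigma}[M]:\mathcal{L}^{\mathcal{P}}_{S,\sigma}[\rho]$, $\Gamma\vdash_\Sigma N:\mathcal{L}^{\mathcal{P}}_{S',\sigma'}[\tau]$, $\sigma=_{\beta\mathcal{L}}\sigma'$, $S=_{\beta\mathcal{L}}S'$ infer $\Gamma\vdash_\Sigma\mathcal{L}^{\mathcal{P}}_{S,\sigma}[M[\mathcal{U}^{\mathcal{P}}_{S',\sigma'}[N]/x]]:\mathcal{L}^{\mathcal{P}}_{S,\sigma}[\rho[\mathcal{U}^{\mathcal{P}}_{S',\sigma'}[N]/x]]$. Closure under signature/context weakening and permutation: if $\Sigma\subseteq\Omega$ are valid signatures and $\mathcal{P}(\Gamma\vdash_\Sigma\alpha)$ then $\mathcal{P}(\Gamma\vdash_\Omega\alpha)$; if $\Gamma\subseteq\Delta$ are valid contexts and $\mathcal{P}(\Gamma\vdash_\Sigma\alpha)$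 then $\mathcal{P}(\Delta\vdash_\Sigma\alpha)$. Closure under substitution: if $\mathcal{P}(\Gamma,x:\sigma',\Gamma'\vdash_\Sigma N:\sigma)$ and $\Gamma\vdash_\Sigma N':\sigma'$ then $\mathcal{P}(\Gamma,\Gamma'[N'/x]\vdash_\Sigma N[N'/x]:\sigma[N'/x])$. -}

module Defs where

-- Variables are de Bruijn indices (index 0 = most recently bound variable);
-- contexts are lists whose head is the most recently declared variable.

open import Data.Nat using (ℕ; zero; suc; _+_)
open import Data.List using (List; []; _∷_; _++_; map; length)
open import Data.List.Membership.Propositional using (_∈_)
open import Data.List.Relation.Binary.Subset.Propositional using (_⊆_)
open import Relation.Binary.Construct.Closure.Equivalence using (EqClosure)
open import Relation.Nullary using (¬_)
open import Relation.Binary.PropositionalEquality using (_≡_)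
open import Function.Definitions using (Injective)

-- names of constants (both family constants a and object constants c)
Name : Set
Name = ℕ

mutual
  data Kind (𝒫 : Set) : Set where
    KType : Kind 𝒫
    KΠ    : Fam 𝒫 → Kind 𝒫 → Kind 𝒫                  -- Π x:σ.K   (K binds index 0)

  data Fam (𝒫 : Set) : Set where
    FCon  : Name → Fam 𝒫
    FΠ    : Fam 𝒫 → Fam 𝒫 → Fam 𝒫                    -- Π x:σ.τ   (τ binds index 0)
    FApp  : Fam 𝒫 → Obj 𝒫 → Fam 𝒫
    FLock : 𝒫 → Obj 𝒫 → Fam 𝒫 → Fam 𝒫 → Fam 𝒫        -- L^P_{N,σ}[ρ]

  data Obj (𝒫 : Set) : Set where
    OCon    : Name → Obj 𝒫
    OVar    : ℕ → Obj 𝒫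
    OLam    : Fam 𝒫 → Obj 𝒫 → Obj 𝒫                  -- λ x:σ.M   (M binds index 0)
    OApp    : Obj 𝒫 → Obj 𝒫 → Obj 𝒫
    OLock   : 𝒫 → Obj 𝒫 → Fam 𝒫 → Obj 𝒫 → Obj 𝒫      -- L^P_{N,σ}[M]
    OUnlock : 𝒫 → Obj 𝒫 → Fam 𝒫 → Obj 𝒫 → Obj 𝒫      -- U^P_{N,σ}[M]

Ren : Set
Ren = ℕ → ℕ

ext : Ren → Ren
ext ρ zero    = zero
ext ρ (suc i) = suc (ρ i)

mutual
  renK : ∀ {𝒫} → Ren → Kind 𝒫 → Kind 𝒫
  renK ρ KType    = KType
  renK ρ (KΠ σ K) = KΠ (renF ρ σ) (renK (ext ρ) K)

  renF : ∀ {𝒫} → Ren → Fam 𝒫 → Fam 𝒫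
  renF ρ (FCon a)        = FCon a
  renF ρ (FΠ σ τ)        = FΠ (renF ρ σ) (renF (ext ρ) τ)
  renF ρ (FApp σ N)      = FApp (renF ρ σ) (renO ρ N)
  renF ρ (FLock P N σ τ) = FLock P (renO ρ N) (renF ρ σ) (renF ρ τ)

  renO : ∀ {𝒫} → Ren → Obj 𝒫 → Obj 𝒫
  renO ρ (OCon c)          = OCon c
  renO ρ (OVar x)          = OVar (ρ x)
  renO ρ (OLam σ M)        = OLam (renF ρ σ) (renO (ext ρ) M)
  renO ρ (OApp M N)        = OApp (renO ρ M) (renO ρ N)
  renO ρ (OLock P N σ M)   = OLock P (renO ρ N) (renF ρ σ) (renO ρ M)
  renO ρ (OUnlock P N σ M) = OUnlock P (renO ρ N) (renF ρ σ) (renO ρ M)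

wkF : ∀ {𝒫} → Fam 𝒫 → Fam 𝒫
wkF = renF suc

wkO : ∀ {𝒫} → Obj 𝒫 → Obj 𝒫
wkO = renO suc

Sub : Set → Set
Sub 𝒫 = ℕ → Obj 𝒫

exts : ∀ {𝒫} → Sub 𝒫 → Sub 𝒫
exts s zero    = OVar zero
exts s (suc i) = renO suc (s i)

mutual
  subK : ∀ {𝒫} → Sub 𝒫 → Kind 𝒫 → Kind 𝒫
  subK s KType    = KType
  subK s (KΠ σ K) = KΠ (subF s σ) (subK (exts s) K)

  subF : ∀ {𝒫} → Sub 𝒫 → Fam 𝒫 → Fam 𝒫
  subF s (FCon a)        = FCon a
  subF s (FΠ σ τ)        = FΠ (subF s σ) (subF (exts s) τ)
  subF s (FApp σ N)      = FApp (subF s σ) (subO s N)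
  subF s (FLock P N σ τ) = FLock P (subO s N) (subF s σ) (subF s τ)

  subO : ∀ {𝒫} → Sub 𝒫 → Obj 𝒫 → Obj 𝒫
  subO s (OCon c)          = OCon c
  subO s (OVar x)          = s x
  subO s (OLam σ M)        = OLam (subF s σ) (subO (exts s) M)
  subO s (OApp M N)        = OApp (subO s M) (subO s N)
  subO s (OLock P N σ M)   = OLock P (subO s N) (subF s σ) (subO s M)
  subO s (OUnlock P N σ M) = OUnlock P (subO s N) (subF s σ) (subO s M)

-- single substitution [N/x] where x is the variable with index k
-- (i.e. x lies under k further binders); N lives in the scope *outside* x,
-- it is shifted by k, and variables above x are decremented.
sub1 : ∀ {𝒫} → ℕ → Obj 𝒫 → Sub 𝒫
sub1 zero    N zero    = N
sub1 zero    N (suc i) = OVar i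
sub1 (suc k) N         = exts (sub1 k N)

_[_/_]K : ∀ {𝒫} → Kind 𝒫 → Obj 𝒫 → ℕ → Kind 𝒫
K [ N / k ]K = subK (sub1 k N) K

_[_/_]F : ∀ {𝒫} → Fam 𝒫 → Obj 𝒫 → ℕ → Fam 𝒫
σ [ N / k ]F = subF (sub1 k N) σ

_[_/_]O : ∀ {𝒫} → Obj 𝒫 → Obj 𝒫 → ℕ → Obj 𝒫
M [ N / k ]O = subO (sub1 k N) M

mutual
  data _⟶K_ {𝒫 : Set} : Kind 𝒫 → Kind 𝒫 → Set where
    KΠ₁ : ∀ {σ σ' K} → σ ⟶F σ' → KΠ σ K ⟶K KΠ σ' K
    KΠ₂ : ∀ {σ K K'} → K ⟶K K' → KΠ σ K ⟶K KΠ σ K'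

  data _⟶F_ {𝒫 : Set} : Fam 𝒫 → Fam 𝒫 → Set where
    FΠ₁    : ∀ {σ σ' τ} → σ ⟶F σ' → FΠ σ τ ⟶F FΠ σ' τ
    FΠ₂    : ∀ {σ τ τ'} → τ ⟶F τ' → FΠ σ τ ⟶F FΠ σ τ'
    FApp₁  : ∀ {σ σ' N} → σ ⟶F σ' → FApp σ N ⟶F FApp σ' N
    FApp₂  : ∀ {σ N N'} → N ⟶O N' → FApp σ N ⟶F FApp σ N'
    FLock₁ : ∀ {P N N' σ ρ} → N ⟶O N' → FLock P N σ ρ ⟶F FLock P N' σ ρ
    FLock₂ : ∀ {P N σ σ' ρ} → σ ⟶F σ' → FLock P N σ ρ ⟶F FLock P N σ' ρ
    FLock₃ : ∀ {P N σ ρ ρ'} → ρ ⟶F ρ' → FLock P N σ ρ ⟶F FLock P N σ ρ'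

  data _⟶O_ {𝒫 : Set} : Obj 𝒫 → Obj 𝒫 → Set where
    β        : ∀ {σ M N} → OApp (OLam σ M) N ⟶O (M [ N / 0 ]O)
    ℒ        : ∀ {P N σ M} → OUnlock P N σ (OLock P N σ M) ⟶O M
    OLam₁    : ∀ {σ σ' M} → σ ⟶F σ' → OLam σ M ⟶O OLam σ' M
    OLam₂    : ∀ {σ M M'} → M ⟶O M' → OLam σ M ⟶O OLam σ M'
    OApp₁    : ∀ {M M' N} → M ⟶O M' → OApp M N ⟶O OApp M' N
    OApp₂    : ∀ {M N N'} → N ⟶O N' → OApp M N ⟶O OApp M N'
    OLock₁   : ∀ {P N N' σ M} → N ⟶O N' → OLock P N σ M ⟶O OLock P N' σ M
    OLock₂   : ∀ {P N σ σ' M} → σ ⟶F σ' → OLock P N σ M ⟶O OLock P N σ' M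
    OLock₃   : ∀ {P N σ M M'} → M ⟶O M' → OLock P N σ M ⟶O OLock P N σ M'
    OUnlock₁ : ∀ {P N N' σ M} → N ⟶O N' → OUnlock P N σ M ⟶O OUnlock P N' σ M
    OUnlock₂ : ∀ {P N σ σ' M} → σ ⟶F σ' → OUnlock P N σ M ⟶O OUnlock P N σ' M
    OUnlock₃ : ∀ {P N σ M M'} → M ⟶O M' → OUnlock P N σ M ⟶O OUnlock P N σ M'

_=K_ : ∀ {𝒫} → Kind 𝒫 → Kind 𝒫 → Set
_=K_ = EqClosure _⟶K_

_=F_ : ∀ {𝒫} → Fam 𝒫 → Fam 𝒫 → Set
_=F_ = EqClosure _⟶F_

_=O_ : ∀ {𝒫} → Obj 𝒫 → Obj 𝒫 → Set
_=O_ = EqClosure _⟶O_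

data Decl (𝒫 : Set) : Set where
  fdecl : Name → Kind 𝒫 → Decl 𝒫
  odecl : Name → Fam 𝒫 → Decl 𝒫

dname : ∀ {𝒫} → Decl 𝒫 → Name
dname (fdecl a _) = a
dname (odecl c _) = c

-- head = most recent declaration
Sig : Set → Set
Sig 𝒫 = List (Decl 𝒫)

Dom : ∀ {𝒫} → Sig 𝒫 → List Name
Dom Σ = map dname Σ

-- head = most recently declared variable (index 0)
Ctx : Set → Set
Ctx 𝒫 = List (Fam 𝒫)

-- x : σ ∈ Γ  (the type is weakened into the scope of the whole context)
data _∋_∶_ {𝒫 : Set} : Ctx 𝒫 → ℕ → Fam 𝒫 → Set where
  here  : ∀ {Γ σ} → (σ ∷ Γ) ∋ zero ∶ wkF σ
  there : ∀ {Γ σ τ i} → Γ ∋ i ∶ σ → (τ ∷ Γ) ∋ suc i ∶ wkF σ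

-- Γ'[N/x] for the context Γ, x:σ, Γ'  (entry of Γ' at depth j gets [N / j])
substCtx : ∀ {𝒫} → Ctx 𝒫 → Obj 𝒫 → Ctx 𝒫
substCtx []        N = []
substCtx (τ ∷ Γ')  N = (τ [ N / length Γ' ]F) ∷ substCtx Γ' N

-- The predicates: interpretation of each predicate name P ∈ 𝒫 on
-- typing judgements  Γ ⊢_Σ N : σ.

Holds : Set → Set₁
Holds 𝒫 = 𝒫 → Sig 𝒫 → Ctx 𝒫 → Obj 𝒫 → Fam 𝒫 → Set

module _ {𝒫 : Set} (holds : Holds 𝒫) where
  mutual
    data SigOK : Sig 𝒫 → Set where
      S-Empty : SigOK []
      S-Fam   : ∀ {Σ a K} → KindOK Σ [] K → ¬ (a ∈ Dom Σ) → SigOK (fdecl a K ∷ Σ)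
      S-Obj   : ∀ {Σ c σ} → FamOK Σ [] σ KType → ¬ (c ∈ Dom Σ) → SigOK (odecl c σ ∷ Σ)

    -- ⊢_Σ Γ   (freshness x ∉ Dom(Γ) is automatic with de Bruijn indices)
    data CtxOK (Σ : Sig 𝒫) : Ctx 𝒫 → Set where
      C-Empty : SigOK Σ → CtxOK Σ []
      C-Ext   : ∀ {Γ σ} → FamOK Σ Γ σ KType → CtxOK Σ (σ ∷ Γ)

    data KindOK (Σ : Sig 𝒫) : Ctx 𝒫 → Kind 𝒫 → Set where
      K-Type : ∀ {Γ} → CtxOK Σ Γ → KindOK Σ Γ KType
      K-Pi   : ∀ {Γ σ K} → KindOK Σ (σ ∷ Γ) K → KindOK Σ Γ (KΠ σ K)

    data FamOK (Σ : Sig 𝒫) : Ctx 𝒫 → Fam 𝒫 → Kind 𝒫 → Set where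
      F-Const : ∀ {Γ a K} → CtxOK Σ Γ → fdecl a K ∈ Σ → FamOK Σ Γ (FCon a) K
      F-Pi    : ∀ {Γ σ τ} → FamOK Σ (σ ∷ Γ) τ KType → FamOK Σ Γ (FΠ σ τ) KType
      F-App   : ∀ {Γ σ τ K N} → FamOK Σ Γ σ (KΠ τ K) → ObjOK Σ Γ N τ →
                FamOK Σ Γ (FApp σ N) (K [ N / 0 ]K)
      F-Lock  : ∀ {Γ P ρ N σ} → FamOK Σ Γ ρ KType → ObjOK Σ Γ N σ →
                FamOK Σ Γ (FLock P N σ ρ) KType
      F-Conv  : ∀ {Γ σ K K'} → FamOK Σ Γ σ K → KindOK Σ Γ K' → K =K K' →
                FamOK Σ Γ σ K'
      -- S, σ do not depend on x (they are weakened into the scope Γ, x:τ)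
      F-Guarded-Unlock : ∀ {Γ P S S' σ σ' ρ τ N} →
                FamOK Σ (τ ∷ Γ) (FLock P (wkO S) (wkF σ) ρ) KType →
                ObjOK Σ Γ N (FLock P S' σ' τ) → σ =F σ' → S =O S' →
                FamOK Σ Γ (FLock P S σ (ρ [ OUnlock P S' σ' N / 0 ]F)) KType

    data ObjOK (Σ : Sig 𝒫) : Ctx 𝒫 → Obj 𝒫 → Fam 𝒫 → Set where
      O-Const : ∀ {Γ c σ} → CtxOK Σ Γ → odecl c σ ∈ Σ → ObjOK Σ Γ (OCon c) σ
      O-Var   : ∀ {Γ x σ} → CtxOK Σ Γ → Γ ∋ x ∶ σ → ObjOK Σ Γ (OVar x) σ
      O-Abs   : ∀ {Γ σ M τ} → ObjOK Σ (σ ∷ Γ) M τ → ObjOK Σ Γ (OLam σ M) (FΠ σ τ)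
      O-App   : ∀ {Γ M N σ τ} → ObjOK Σ Γ M (FΠ σ τ) → ObjOK Σ Γ N σ →
                ObjOK Σ Γ (OApp M N) (τ [ N / 0 ]F)
      O-Conv  : ∀ {Γ M σ τ} → ObjOK Σ Γ M σ → FamOK Σ Γ τ KType → σ =F τ →
                ObjOK Σ Γ M τ
      O-Lock  : ∀ {Γ P M ρ N σ} → ObjOK Σ Γ M ρ → ObjOK Σ Γ N σ →
                ObjOK Σ Γ (OLock P N σ M) (FLock P N σ ρ)
      O-Top-Unlock : ∀ {Γ P M N σ ρ} → ObjOK Σ Γ M (FLock P N σ ρ) →
                holds P Σ Γ N σ → ObjOK Σ Γ (OUnlock P N σ M) ρ
      O-Guarded-Unlock : ∀ {Γ P S S' σ σ' M ρ τ N} →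
                ObjOK Σ (τ ∷ Γ) (OLock P (wkO S) (wkF σ) M) (FLock P (wkO S) (wkF σ) ρ) →
                ObjOK Σ Γ N (FLock P S' σ' τ) → σ =F σ' → S =O S' →
                ObjOK Σ Γ (OLock P S σ (M [ OUnlock P S' σ' N / 0 ]O))
                          (FLock P S σ (ρ [ OUnlock P S' σ' N / 0 ]F))

SigWeakClosed : ∀ {𝒫} → Holds 𝒫 → Set
SigWeakClosed {𝒫} holds =
  ∀ {P : 𝒫} {Σ Ω Γ N σ} → SigOK holds Σ → SigOK holds Ω → Σ ⊆ Ω →
  holds P Σ Γ N σ → holds P Ω Γ N σ

-- closure under context weakening and permutation: Γ ⊆ Δ is witnessed by
-- an injective renaming ρ mapping each declaration x:τ of Γ to a
-- declaration ρ(x):τ of Δ.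
CtxWeakClosed : ∀ {𝒫} → Holds 𝒫 → Set
CtxWeakClosed {𝒫} holds =
  ∀ {P : 𝒫} {Σ Γ Δ N σ} (ρ : Ren) → CtxOK holds Σ Γ → CtxOK holds Σ Δ →
  Injective _≡_ _≡_ ρ → (∀ {i τ} → Γ ∋ i ∶ τ → Δ ∋ ρ i ∶ renF ρ τ) →
  holds P Σ Γ N σ → holds P Σ Δ (renO ρ N) (renF ρ σ)

SubstClosed : ∀ {𝒫} → Holds 𝒫 → Set
SubstClosed {𝒫} holds =
  ∀ {P : 𝒫} {Σ Γ Γ' σ' N σ N'} →
  holds P Σ (Γ' ++ σ' ∷ Γ) N σ → ObjOK holds Σ Γ N' σ' →
  holds P Σ (substCtx Γ' N' ++ Γ) (N [ N' / length Γ' ]O) (σ [ N' / length Γ' ]F)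

module Submission where

-- The proof is the classical one: induction on the typing derivation of
-- Γ, x:σ, Γ' ⊢ α, replacing x by N everywhere.  Three kinds of facts are
-- needed besides the induction itself, and the file develops them in order.
--   1. Substitution algebra for the de Bruijn syntax of Defs: extensionality,
--      renaming as substitution, identity and the fusion laws, from which
--      substitution commutes with β-instantiation [N/0] and with weakening;
--      hence βL-conversion is stable under substitution and renaming.
--   2. Scoping: every term of a derivable judgement lives in its context, in
--      the semantic sense that its value under a substitution only depends on
--      the variables of the context.  In particular the declarations of a valid
--      signature are closed, so substitution leaves them unchanged (F-Const, O-Const).
--   3. Weakening by one variable, needed for the variable case.  Here the
--      predicates must be closed under context weakening (rule O-Top-Unlock).
-- The substitution lemma then follows by mutual induction on kinds, families
-- and objects; its O-Top-Unlock case is exactly the closure of the predicates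
-- under substitution.

open import Data.Nat using (ℕ; zero; suc; _<_; z≤n; s≤s)
open import Data.Nat.Properties using (suc-injective)
open import Data.List using ([]; _∷_; _++_; length)
open import Data.List.Membership.Propositional using (_∈_)
open import Data.List.Relation.Unary.All using (All; []; _∷_) renaming (lookup to lookupAll)
open import Data.Product using (_×_; _,_; proj₁; proj₂)
open import Data.Unit using (⊤; tt)
open import Function.Base using (_∘_)
open import Function.Definitions using (Injective)
open import Relation.Binary.PropositionalEquality
  using (_≡_; _≗_; refl; sym; trans; cong; cong₂; subst; subst₂; module ≡-Reasoning)
open import Relation.Binary.Construct.Closure.Equivalence using (EqClosure; gmap)

open import Defs

cong₃ : ∀ {A B C D : Set} (f : A → B → C → D) {a a' b b' c c'} →
        a ≡ a' → b ≡ b' → c ≡ c' → f a b c ≡ f a' b' c'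
cong₃ f refl refl refl = refl

-- The three syntactic categories, so that each law of the substitution
-- algebra is stated once for kinds, families and objects.
data Sort : Set where
  kind fam obj : Sort

module _ {𝒫 : Set} where

  Tm : Sort → Set
  Tm kind = Kind 𝒫
  Tm fam  = Fam 𝒫
  Tm obj  = Obj 𝒫

  sub : ∀ k → Sub 𝒫 → Tm k → Tm k
  sub kind = subK
  sub fam  = subF
  sub obj  = subO

  ren : ∀ k → Ren → Tm k → Tm k
  ren kind = renK
  ren fam  = renF
  ren obj  = renO

  Red : ∀ k → Tm k → Tm k → Set
  Red kind = _⟶K_
  Red fam  = _⟶F_
  Red obj  = _⟶O_

  exts-cong : ∀ {s s' : Sub 𝒫} → s ≗ s' → exts s ≗ exts s'
  exts-cong e zero    = refl
  exts-cong e (suc i) = cong wkO (e i)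

  sub-cong : ∀ k {s s'} → s ≗ s' → (t : Tm k) → sub k s t ≡ sub k s' t
  sub-cong kind e KType             = refl
  sub-cong kind e (KΠ σ K)          = cong₂ KΠ (sub-cong fam e σ) (sub-cong kind (exts-cong e) K)
  sub-cong fam  e (FCon a)          = refl
  sub-cong fam  e (FΠ σ τ)          = cong₂ FΠ (sub-cong fam e σ) (sub-cong fam (exts-cong e) τ)
  sub-cong fam  e (FApp σ N)        = cong₂ FApp (sub-cong fam e σ) (sub-cong obj e N)
  sub-cong fam  e (FLock P N σ ρ)   = cong₃ (FLock P) (sub-cong obj e N) (sub-cong fam e σ) (sub-cong fam e ρ)
  sub-cong obj  e (OCon c)          = refl
  sub-cong obj  e (OVar x)          = e x
  sub-cong obj  e (OLam σ M)        = cong₂ OLam (sub-cong fam e σ) (sub-cong obj (exts-cong e) M)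
  sub-cong obj  e (OApp M N)        = cong₂ OApp (sub-cong obj e M) (sub-cong obj e N)
  sub-cong obj  e (OLock P N σ M)   = cong₃ (OLock P) (sub-cong obj e N) (sub-cong fam e σ) (sub-cong obj e M)
  sub-cong obj  e (OUnlock P N σ M) = cong₃ (OUnlock P) (sub-cong obj e N) (sub-cong fam e σ) (sub-cong obj e M)

  ext-as-exts : ∀ (ρ : Ren) → exts {𝒫} (OVar ∘ ρ) ≗ OVar ∘ ext ρ
  ext-as-exts ρ zero    = refl
  ext-as-exts ρ (suc i) = refl

  ren-as-sub : ∀ k ρ (t : Tm k) → ren k ρ t ≡ sub k (OVar ∘ ρ) t
  ren-as-sub kind ρ KType             = refl
  ren-as-sub kind ρ (KΠ σ K)          = cong₂ KΠ (ren-as-sub fam ρ σ)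
    (trans (ren-as-sub kind (ext ρ) K) (sym (sub-cong kind (ext-as-exts ρ) K)))
  ren-as-sub fam  ρ (FCon a)          = refl
  ren-as-sub fam  ρ (FΠ σ τ)          = cong₂ FΠ (ren-as-sub fam ρ σ)
    (trans (ren-as-sub fam (ext ρ) τ) (sym (sub-cong fam (ext-as-exts ρ) τ)))
  ren-as-sub fam  ρ (FApp σ N)        = cong₂ FApp (ren-as-sub fam ρ σ) (ren-as-sub obj ρ N)
  ren-as-sub fam  ρ (FLock P N σ τ)   = cong₃ (FLock P) (ren-as-sub obj ρ N) (ren-as-sub fam ρ σ) (ren-as-sub fam ρ τ)
  ren-as-sub obj  ρ (OCon c)          = refl
  ren-as-sub obj  ρ (OVar x)          = refl
  ren-as-sub obj  ρ (OLam σ M)        = cong₂ OLam (ren-as-sub fam ρ σ)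
    (trans (ren-as-sub obj (ext ρ) M) (sym (sub-cong obj (ext-as-exts ρ) M)))
  ren-as-sub obj  ρ (OApp M N)        = cong₂ OApp (ren-as-sub obj ρ M) (ren-as-sub obj ρ N)
  ren-as-sub obj  ρ (OLock P N σ M)   = cong₃ (OLock P) (ren-as-sub obj ρ N) (ren-as-sub fam ρ σ) (ren-as-sub obj ρ M)
  ren-as-sub obj  ρ (OUnlock P N σ M) = cong₃ (OUnlock P) (ren-as-sub obj ρ N) (ren-as-sub fam ρ σ) (ren-as-sub obj ρ M)

  exts-id : exts {𝒫} OVar ≗ OVar
  exts-id zero    = refl
  exts-id (suc i) = refl

  sub-id : ∀ k (t : Tm k) → sub k OVar t ≡ t
  sub-id kind KType             = refl
  sub-id kind (KΠ σ K)          = cong₂ KΠ (sub-id fam σ) (trans (sub-cong kind exts-id K) (sub-id kind K))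
  sub-id fam  (FCon a)          = refl
  sub-id fam  (FΠ σ τ)          = cong₂ FΠ (sub-id fam σ) (trans (sub-cong fam exts-id τ) (sub-id fam τ))
  sub-id fam  (FApp σ N)        = cong₂ FApp (sub-id fam σ) (sub-id obj N)
  sub-id fam  (FLock P N σ τ)   = cong₃ (FLock P) (sub-id obj N) (sub-id fam σ) (sub-id fam τ)
  sub-id obj  (OCon c)          = refl
  sub-id obj  (OVar x)          = refl
  sub-id obj  (OLam σ M)        = cong₂ OLam (sub-id fam σ) (trans (sub-cong obj exts-id M) (sub-id obj M))
  sub-id obj  (OApp M N)        = cong₂ OApp (sub-id obj M) (sub-id obj N)
  sub-id obj  (OLock P N σ M)   = cong₃ (OLock P) (sub-id obj N) (sub-id fam σ) (sub-id obj M)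
  sub-id obj  (OUnlock P N σ M) = cong₃ (OUnlock P) (sub-id obj N) (sub-id fam σ) (sub-id obj M)

  exts-after-ext : ∀ (s : Sub 𝒫) ρ → exts s ∘ ext ρ ≗ exts (s ∘ ρ)
  exts-after-ext s ρ zero    = refl
  exts-after-ext s ρ (suc i) = refl

  sub-ren : ∀ k (s : Sub 𝒫) ρ (t : Tm k) → sub k s (ren k ρ t) ≡ sub k (s ∘ ρ) t
  sub-ren kind s ρ KType             = refl
  sub-ren kind s ρ (KΠ σ K)          = cong₂ KΠ (sub-ren fam s ρ σ)
    (trans (sub-ren kind (exts s) (ext ρ) K) (sub-cong kind (exts-after-ext s ρ) K))
  sub-ren fam  s ρ (FCon a)          = refl
  sub-ren fam  s ρ (FΠ σ τ)          = cong₂ FΠ (sub-ren fam s ρ σ)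
    (trans (sub-ren fam (exts s) (ext ρ) τ) (sub-cong fam (exts-after-ext s ρ) τ))
  sub-ren fam  s ρ (FApp σ N)        = cong₂ FApp (sub-ren fam s ρ σ) (sub-ren obj s ρ N)
  sub-ren fam  s ρ (FLock P N σ τ)   = cong₃ (FLock P) (sub-ren obj s ρ N) (sub-ren fam s ρ σ) (sub-ren fam s ρ τ)
  sub-ren obj  s ρ (OCon c)          = refl
  sub-ren obj  s ρ (OVar x)          = refl
  sub-ren obj  s ρ (OLam σ M)        = cong₂ OLam (sub-ren fam s ρ σ)
    (trans (sub-ren obj (exts s) (ext ρ) M) (sub-cong obj (exts-after-ext s ρ) M))
  sub-ren obj  s ρ (OApp M N)        = cong₂ OApp (sub-ren obj s ρ M) (sub-ren obj s ρ N)
  sub-ren obj  s ρ (OLock P N σ M)   = cong₃ (OLock P) (sub-ren obj s ρ N) (sub-ren fam s ρ σ) (sub-ren obj s ρ M)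
  sub-ren obj  s ρ (OUnlock P N σ M) = cong₃ (OUnlock P) (sub-ren obj s ρ N) (sub-ren fam s ρ σ) (sub-ren obj s ρ M)

  ren-ren : ∀ k ρ ρ' (t : Tm k) → ren k ρ (ren k ρ' t) ≡ ren k (ρ ∘ ρ') t
  ren-ren k ρ ρ' t = begin
    ren k ρ (ren k ρ' t)             ≡⟨ ren-as-sub k ρ (ren k ρ' t) ⟩
    sub k (OVar ∘ ρ) (ren k ρ' t)    ≡⟨ sub-ren k (OVar ∘ ρ) ρ' t ⟩
    sub k (OVar ∘ ρ ∘ ρ') t          ≡⟨ sym (ren-as-sub k (ρ ∘ ρ') t) ⟩
    ren k (ρ ∘ ρ') t                 ∎
    where open ≡-Reasoning

  ren-wk : ∀ k ρ (t : Tm k) → ren k (ext ρ) (ren k suc t) ≡ ren k suc (ren k ρ t)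
  ren-wk k ρ t = trans (ren-ren k (ext ρ) suc t) (sym (ren-ren k suc ρ t))

  ext-after-exts : ∀ ρ (s : Sub 𝒫) → renO (ext ρ) ∘ exts s ≗ exts (renO ρ ∘ s)
  ext-after-exts ρ s zero    = refl
  ext-after-exts ρ s (suc i) = ren-wk obj ρ (s i)

  ren-sub : ∀ k ρ (s : Sub 𝒫) (t : Tm k) → ren k ρ (sub k s t) ≡ sub k (renO ρ ∘ s) t
  ren-sub kind ρ s KType             = refl
  ren-sub kind ρ s (KΠ σ K)          = cong₂ KΠ (ren-sub fam ρ s σ)
    (trans (ren-sub kind (ext ρ) (exts s) K) (sub-cong kind (ext-after-exts ρ s) K))
  ren-sub fam  ρ s (FCon a)          = refl
  ren-sub fam  ρ s (FΠ σ τ)          = cong₂ FΠ (ren-sub fam ρ s σ)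
    (trans (ren-sub fam (ext ρ) (exts s) τ) (sub-cong fam (ext-after-exts ρ s) τ))
  ren-sub fam  ρ s (FApp σ N)        = cong₂ FApp (ren-sub fam ρ s σ) (ren-sub obj ρ s N)
  ren-sub fam  ρ s (FLock P N σ τ)   = cong₃ (FLock P) (ren-sub obj ρ s N) (ren-sub fam ρ s σ) (ren-sub fam ρ s τ)
  ren-sub obj  ρ s (OCon c)          = refl
  ren-sub obj  ρ s (OVar x)          = refl
  ren-sub obj  ρ s (OLam σ M)        = cong₂ OLam (ren-sub fam ρ s σ)
    (trans (ren-sub obj (ext ρ) (exts s) M) (sub-cong obj (ext-after-exts ρ s) M))
  ren-sub obj  ρ s (OApp M N)        = cong₂ OApp (ren-sub obj ρ s M) (ren-sub obj ρ s N)
  ren-sub obj  ρ s (OLock P N σ M)   = cong₃ (OLock P) (ren-sub obj ρ s N) (ren-sub fam ρ s σ) (ren-sub obj ρ s M)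
  ren-sub obj  ρ s (OUnlock P N σ M) = cong₃ (OUnlock P) (ren-sub obj ρ s N) (ren-sub fam ρ s σ) (ren-sub obj ρ s M)

  sub-wk : ∀ k (s : Sub 𝒫) (t : Tm k) → sub k (exts s) (ren k suc t) ≡ ren k suc (sub k s t)
  sub-wk k s t = trans (sub-ren k (exts s) suc t) (sym (ren-sub k suc s t))

  exts-after-exts : ∀ (s s' : Sub 𝒫) → subO (exts s) ∘ exts s' ≗ exts (subO s ∘ s')
  exts-after-exts s s' zero    = refl
  exts-after-exts s s' (suc i) = sub-wk obj s (s' i)

  sub-sub : ∀ k (s s' : Sub 𝒫) (t : Tm k) → sub k s (sub k s' t) ≡ sub k (subO s ∘ s') t
  sub-sub kind s s' KType             = refl
  sub-sub kind s s' (KΠ σ K)          = cong₂ KΠ (sub-sub fam s s' σ)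
    (trans (sub-sub kind (exts s) (exts s') K) (sub-cong kind (exts-after-exts s s') K))
  sub-sub fam  s s' (FCon a)          = refl
  sub-sub fam  s s' (FΠ σ τ)          = cong₂ FΠ (sub-sub fam s s' σ)
    (trans (sub-sub fam (exts s) (exts s') τ) (sub-cong fam (exts-after-exts s s') τ))
  sub-sub fam  s s' (FApp σ N)        = cong₂ FApp (sub-sub fam s s' σ) (sub-sub obj s s' N)
  sub-sub fam  s s' (FLock P N σ τ)   = cong₃ (FLock P) (sub-sub obj s s' N) (sub-sub fam s s' σ) (sub-sub fam s s' τ)
  sub-sub obj  s s' (OCon c)          = refl
  sub-sub obj  s s' (OVar x)          = refl
  sub-sub obj  s s' (OLam σ M)        = cong₂ OLam (sub-sub fam s s' σ)
    (trans (sub-sub obj (exts s) (exts s') M) (sub-cong obj (exts-after-exts s s') M))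
  sub-sub obj  s s' (OApp M N)        = cong₂ OApp (sub-sub obj s s' M) (sub-sub obj s s' N)
  sub-sub obj  s s' (OLock P N σ M)   = cong₃ (OLock P) (sub-sub obj s s' N) (sub-sub fam s s' σ) (sub-sub obj s s' M)
  sub-sub obj  s s' (OUnlock P N σ M) = cong₃ (OUnlock P) (sub-sub obj s s' N) (sub-sub fam s s' σ) (sub-sub obj s s' M)

  sub-β-pointwise : ∀ (s : Sub 𝒫) N → subO s ∘ sub1 0 N ≗ subO (sub1 0 (subO s N)) ∘ exts s
  sub-β-pointwise s N zero    = refl
  sub-β-pointwise s N (suc i) = sym (trans (sub-ren obj (sub1 0 (subO s N)) suc (s i)) (sub-id obj (s i)))

  sub-β : ∀ k (s : Sub 𝒫) N (t : Tm k) →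
          sub k s (sub k (sub1 0 N) t) ≡ sub k (sub1 0 (subO s N)) (sub k (exts s) t)
  sub-β k s N t = begin
    sub k s (sub k (sub1 0 N) t)                   ≡⟨ sub-sub k s (sub1 0 N) t ⟩
    sub k (subO s ∘ sub1 0 N) t                    ≡⟨ sub-cong k (sub-β-pointwise s N) t ⟩
    sub k (subO (sub1 0 (subO s N)) ∘ exts s) t    ≡⟨ sym (sub-sub k (sub1 0 (subO s N)) (exts s) t) ⟩
    sub k (sub1 0 (subO s N)) (sub k (exts s) t)   ∎
    where open ≡-Reasoning

  ren-β : ∀ k ρ N (t : Tm k) →
          ren k ρ (sub k (sub1 0 N) t) ≡ sub k (sub1 0 (renO ρ N)) (ren k (ext ρ) t)
  ren-β k ρ N t = begin
    ren k ρ (sub k (sub1 0 N) t)                              ≡⟨ ren-as-sub k ρ _ ⟩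
    sub k (OVar ∘ ρ) (sub k (sub1 0 N) t)                     ≡⟨ sub-β k (OVar ∘ ρ) N t ⟩
    sub k (sub1 0 (subO (OVar ∘ ρ) N)) (sub k (exts (OVar ∘ ρ)) t)
      ≡⟨ cong₂ (λ u v → sub k (sub1 0 u) v) (sym (ren-as-sub obj ρ N))
               (trans (sub-cong k (ext-as-exts ρ) t) (sym (ren-as-sub k (ext ρ) t))) ⟩
    sub k (sub1 0 (renO ρ N)) (ren k (ext ρ) t)               ∎
    where open ≡-Reasoning

  red-sub : ∀ k (s : Sub 𝒫) {t t'} → Red k t t' → Red k (sub k s t) (sub k s t')
  red-sub kind s (KΠ₁ r)      = KΠ₁ (red-sub fam s r)
  red-sub kind s (KΠ₂ r)      = KΠ₂ (red-sub kind (exts s) r)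
  red-sub fam  s (FΠ₁ r)      = FΠ₁ (red-sub fam s r)
  red-sub fam  s (FΠ₂ r)      = FΠ₂ (red-sub fam (exts s) r)
  red-sub fam  s (FApp₁ r)    = FApp₁ (red-sub fam s r)
  red-sub fam  s (FApp₂ r)    = FApp₂ (red-sub obj s r)
  red-sub fam  s (FLock₁ r)   = FLock₁ (red-sub obj s r)
  red-sub fam  s (FLock₂ r)   = FLock₂ (red-sub fam s r)
  red-sub fam  s (FLock₃ r)   = FLock₃ (red-sub fam s r)
  red-sub obj  s (β {σ} {M} {N}) =
    subst (subO s (OApp (OLam σ M) N) ⟶O_) (sym (sub-β obj s N M)) β
  red-sub obj  s ℒ            = ℒ
  red-sub obj  s (OLam₁ r)    = OLam₁ (red-sub fam s r)
  red-sub obj  s (OLam₂ r)    = OLam₂ (red-sub obj (exts s) r)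
  red-sub obj  s (OApp₁ r)    = OApp₁ (red-sub obj s r)
  red-sub obj  s (OApp₂ r)    = OApp₂ (red-sub obj s r)
  red-sub obj  s (OLock₁ r)   = OLock₁ (red-sub obj s r)
  red-sub obj  s (OLock₂ r)   = OLock₂ (red-sub fam s r)
  red-sub obj  s (OLock₃ r)   = OLock₃ (red-sub obj s r)
  red-sub obj  s (OUnlock₁ r) = OUnlock₁ (red-sub obj s r)
  red-sub obj  s (OUnlock₂ r) = OUnlock₂ (red-sub fam s r)
  red-sub obj  s (OUnlock₃ r) = OUnlock₃ (red-sub obj s r)

  conv-sub : ∀ k (s : Sub 𝒫) {t t'} → EqClosure (Red k) t t' → EqClosure (Red k) (sub k s t) (sub k s t')
  conv-sub k s = gmap (sub k s) (red-sub k s)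

  conv-ren : ∀ k ρ {t t' : Tm k} → EqClosure (Red k) t t' → EqClosure (Red k) (ren k ρ t) (ren k ρ t')
  conv-ren k ρ {t} {t'} e =
    subst₂ (EqClosure (Red k)) (sym (ren-as-sub k ρ t)) (sym (ren-as-sub k ρ t')) (conv-sub k (OVar ∘ ρ) e)

  Agree : ℕ → Sub 𝒫 → Sub 𝒫 → Set
  Agree n s s' = ∀ i → i < n → s i ≡ s' i

  record Scoped (k : Sort) (n : ℕ) (t : Tm k) : Set where
    constructor scoped
    field agree : ∀ {s s'} → Agree n s s' → sub k s t ≡ sub k s' t
  open Scoped public

  -- t is the body of a binder in a term scoped in n variables: it is scoped
  -- in n+1 variables as seen through lifted substitutions
  record ScopedBody (k : Sort) (n : ℕ) (t : Tm k) : Set where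
    constructor scoped-under
    field agree-under : ∀ {s s'} → Agree n s s' → sub k (exts s) t ≡ sub k (exts s') t
  open ScopedBody public

  agree-exts : ∀ {n s s'} → Agree n s s' → Agree (suc n) (exts s) (exts s')
  agree-exts a zero    _       = refl
  agree-exts a (suc i) (s≤s p) = cong wkO (a i p)

  agree-none : ∀ s s' → Agree 0 s s'
  agree-none s s' i ()

  scoped-body : ∀ {k n t} → Scoped k (suc n) t → ScopedBody k n t
  scoped-body h = scoped-under λ a → agree h (agree-exts a)

  scoped-mono : ∀ {k n t} → Scoped k 0 t → Scoped k n t
  scoped-mono h = scoped λ {s} {s'} _ → agree h (agree-none s s')

  closed-sub : ∀ {k t} → Scoped k 0 t → ∀ s → sub k s t ≡ t
  closed-sub {k} {t} h s = trans (agree h (agree-none s OVar)) (sub-id k t)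

  closed-ren : ∀ {k t} → Scoped k 0 t → ∀ ρ → ren k ρ t ≡ t
  closed-ren {k} {t} h ρ = trans (ren-as-sub k ρ t) (closed-sub h (OVar ∘ ρ))

  scoped-wk : ∀ {k n t} → Scoped k n t → Scoped k (suc n) (ren k suc t)
  scoped-wk {k} {n} {t} h = scoped λ {s} {s'} a →
    trans (sub-ren k s suc t) (trans (agree h (λ i p → a (suc i) (s≤s p))) (sym (sub-ren k s' suc t)))

  -- conversely a weakened term scoped in n+1 variables is scoped in n
  -- (substitute an arbitrary term for the fresh variable 0)
  cons : Obj 𝒫 → Sub 𝒫 → Sub 𝒫
  cons M s zero    = M
  cons M s (suc i) = s i

  agree-cons : ∀ {n s s'} M → Agree n s s' → Agree (suc n) (cons M s) (cons M s')
  agree-cons M a zero    _       = refl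
  agree-cons M a (suc i) (s≤s p) = a i p

  scoped-unwk : ∀ {k n t} → Scoped k (suc n) (ren k suc t) → Scoped k n t
  scoped-unwk {k} {n} {t} h = scoped λ {s} {s'} a →
    trans (sym (sub-ren k (cons (OVar 0) s) suc t))
          (trans (agree h (agree-cons (OVar 0) a)) (sub-ren k (cons (OVar 0) s') suc t))

  scoped-inst : ∀ {k n t U} → ScopedBody k n t → Scoped obj n U → Scoped k n (sub k (sub1 0 U) t)
  scoped-inst {k} {n} {t} {U} hb hU = scoped λ {s} {s'} a → begin
    sub k s (sub k (sub1 0 U) t)                    ≡⟨ sub-β k s U t ⟩
    sub k (sub1 0 (subO s U)) (sub k (exts s) t)    ≡⟨ cong₂ (λ u v → sub k (sub1 0 u) v) (agree hU a) (agree-under hb a) ⟩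
    sub k (sub1 0 (subO s' U)) (sub k (exts s') t)  ≡⟨ sym (sub-β k s' U t) ⟩
    sub k s' (sub k (sub1 0 U) t)                   ∎
    where open ≡-Reasoning

  scoped-KType : ∀ {n} → Scoped kind n KType
  scoped-KType = scoped λ _ → refl

  scoped-var : ∀ {n i} → i < n → Scoped obj n (OVar i)
  scoped-var lt = scoped λ a → a _ lt

  scoped-KΠ : ∀ {n σ K} → Scoped fam n σ → Scoped kind (suc n) K → Scoped kind n (KΠ σ K)
  scoped-KΠ hσ hK = scoped λ a → cong₂ KΠ (agree hσ a) (agree hK (agree-exts a))

  scoped-FΠ : ∀ {n σ τ} → Scoped fam n σ → Scoped fam (suc n) τ → Scoped fam n (FΠ σ τ)
  scoped-FΠ hσ hτ = scoped λ a → cong₂ FΠ (agree hσ a) (agree hτ (agree-exts a))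

  scoped-OLam : ∀ {n σ M} → Scoped fam n σ → Scoped obj (suc n) M → Scoped obj n (OLam σ M)
  scoped-OLam hσ hM = scoped λ a → cong₂ OLam (agree hσ a) (agree hM (agree-exts a))

  scoped-FApp : ∀ {n σ N} → Scoped fam n σ → Scoped obj n N → Scoped fam n (FApp σ N)
  scoped-FApp hσ hN = scoped λ a → cong₂ FApp (agree hσ a) (agree hN a)

  scoped-OApp : ∀ {n M N} → Scoped obj n M → Scoped obj n N → Scoped obj n (OApp M N)
  scoped-OApp hM hN = scoped λ a → cong₂ OApp (agree hM a) (agree hN a)

  scoped-FLock : ∀ {n P N σ ρ} → Scoped obj n N → Scoped fam n σ → Scoped fam n ρ →
                 Scoped fam n (FLock P N σ ρ)
  scoped-FLock hN hσ hρ = scoped λ a → cong₃ (FLock _) (agree hN a) (agree hσ a) (agree hρ a)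

  scoped-OLock : ∀ {n P N σ M} → Scoped obj n N → Scoped fam n σ → Scoped obj n M →
                 Scoped obj n (OLock P N σ M)
  scoped-OLock hN hσ hM = scoped λ a → cong₃ (OLock _) (agree hN a) (agree hσ a) (agree hM a)

  scoped-OUnlock : ∀ {n P N σ M} → Scoped obj n N → Scoped fam n σ → Scoped obj n M →
                   Scoped obj n (OUnlock P N σ M)
  scoped-OUnlock hN hσ hM = scoped λ a → cong₃ (OUnlock _) (agree hN a) (agree hσ a) (agree hM a)

  KΠ-injectiveʳ : ∀ {σ σ' : Fam 𝒫} {K K'} → KΠ σ K ≡ KΠ σ' K' → K ≡ K'
  KΠ-injectiveʳ refl = refl

  FΠ-injectiveʳ : ∀ {σ σ' τ τ' : Fam 𝒫} → FΠ σ τ ≡ FΠ σ' τ' → τ ≡ τ'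
  FΠ-injectiveʳ refl = refl

  body-KΠ : ∀ {n σ K} → Scoped kind n (KΠ σ K) → ScopedBody kind n K
  body-KΠ h = scoped-under λ a → KΠ-injectiveʳ (agree h a)

  body-FΠ : ∀ {n σ τ} → Scoped fam n (FΠ σ τ) → ScopedBody fam n τ
  body-FΠ h = scoped-under λ a → FΠ-injectiveʳ (agree h a)

  FLock-injective : ∀ {P P'} {N N' σ σ' ρ ρ'} → FLock {𝒫} P N σ ρ ≡ FLock P' N' σ' ρ' →
                    N ≡ N' × σ ≡ σ' × ρ ≡ ρ'
  FLock-injective refl = refl , refl , refl

  OLock-injective : ∀ {P P'} {N N' σ σ' M M'} → OLock {𝒫} P N σ M ≡ OLock P' N' σ' M' →
                    N ≡ N' × σ ≡ σ' × M ≡ M'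
  OLock-injective refl = refl , refl , refl

  inv-FLock : ∀ {n P N σ ρ} → Scoped fam n (FLock P N σ ρ) →
              Scoped obj n N × Scoped fam n σ × Scoped fam n ρ
  inv-FLock h = scoped (proj₁ ∘ FLock-injective ∘ agree h)
              , scoped (proj₁ ∘ proj₂ ∘ FLock-injective ∘ agree h)
              , scoped (proj₂ ∘ proj₂ ∘ FLock-injective ∘ agree h)

  inv-OLock : ∀ {n P N σ M} → Scoped obj n (OLock P N σ M) →
              Scoped obj n N × Scoped fam n σ × Scoped obj n M
  inv-OLock h = scoped (proj₁ ∘ OLock-injective ∘ agree h)
              , scoped (proj₁ ∘ proj₂ ∘ OLock-injective ∘ agree h)
              , scoped (proj₂ ∘ proj₂ ∘ OLock-injective ∘ agree h)

  ScopedCtx : Ctx 𝒫 → Set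
  ScopedCtx []      = ⊤
  ScopedCtx (σ ∷ Γ) = Scoped fam (length Γ) σ × ScopedCtx Γ

  ScopedDecl : Decl 𝒫 → Set
  ScopedDecl (fdecl _ K) = Scoped kind 0 K
  ScopedDecl (odecl _ σ) = Scoped fam 0 σ

  ScopedEnv : Sig 𝒫 → Ctx 𝒫 → Set
  ScopedEnv Σ Γ = All ScopedDecl Σ × ScopedCtx Γ

  scoped-lookup : ∀ {Γ i τ} → Γ ∋ i ∶ τ → ScopedCtx Γ → i < length Γ × Scoped fam (length Γ) τ
  scoped-lookup here      (hσ , _) = s≤s z≤n , scoped-wk hσ
  scoped-lookup (there p) (_ , hΓ) with scoped-lookup p hΓ
  ... | lt , hτ = s≤s lt , scoped-wk hτ

module Structure {𝒫 : Set} (holds : Holds 𝒫) where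

  -- The signature and context are shown scoped
  -- along the way: the scope of the domain of a binder is only available from
  -- the context validity proofs at the leaves of the derivation.
  mutual
    scope-sig : ∀ {Σ} → SigOK holds Σ → All ScopedDecl Σ
    scope-sig S-Empty    = []
    scope-sig (S-Fam k _) with scope-kind k
    ... | hK , hΣ , _ = hK ∷ hΣ
    scope-sig (S-Obj f _) with scope-fam f
    ... | (hσ , _) , hΣ , _ = hσ ∷ hΣ

    scope-ctx : ∀ {Σ Γ} → CtxOK holds Σ Γ → ScopedEnv Σ Γ
    scope-ctx (C-Empty s) = scope-sig s , tt
    scope-ctx (C-Ext f) with scope-fam f
    ... | (hσ , _) , hΣ , hΓ = hΣ , (hσ , hΓ)

    scope-kind : ∀ {Σ Γ K} → KindOK holds Σ Γ K → Scoped kind (length Γ) K × ScopedEnv Σ Γ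
    scope-kind (K-Type c) = scoped-KType , scope-ctx c
    scope-kind (K-Pi d) with scope-kind d
    ... | hK , hΣ , (hσ , hΓ) = scoped-KΠ hσ hK , hΣ , hΓ

    scope-fam : ∀ {Σ Γ σ K} → FamOK holds Σ Γ σ K →
                (Scoped fam (length Γ) σ × Scoped kind (length Γ) K) × ScopedEnv Σ Γ
    scope-fam (F-Const c m) with scope-ctx c
    ... | hΣ , hΓ = (scoped (λ _ → refl) , scoped-mono (lookupAll hΣ m)) , hΣ , hΓ
    scope-fam (F-Pi d) with scope-fam d
    ... | (hτ , _) , hΣ , (hσ , hΓ) = (scoped-FΠ hσ hτ , scoped-KType) , hΣ , hΓ
    scope-fam (F-App d e) with scope-fam d | scope-obj e
    ... | (hσ , hΠ) , env | (hN , _) , _ = (scoped-FApp hσ hN , scoped-inst (body-KΠ hΠ) hN) , env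
    scope-fam (F-Lock d e) with scope-fam d | scope-obj e
    ... | (hρ , _) , env | (hN , hσ) , _ = (scoped-FLock hN hσ hρ , scoped-KType) , env
    scope-fam (F-Conv d k _) with scope-fam d | scope-kind k
    ... | (hσ , _) , env | hK , _ = (hσ , hK) , env
    scope-fam (F-Guarded-Unlock d e _ _) with scope-fam d | scope-obj e
    ... | (hL , _) , hΣ , (_ , hΓ) | (hN , hT) , _ with inv-FLock hL | inv-FLock hT
    ... | hwS , hwσ , hρ | hS' , hσ' , _ =
      (scoped-FLock (scoped-unwk hwS) (scoped-unwk hwσ)
                    (scoped-inst (scoped-body hρ) (scoped-OUnlock hS' hσ' hN)) ,
       scoped-KType) , hΣ , hΓ

    scope-obj : ∀ {Σ Γ M τ} → ObjOK holds Σ Γ M τ →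
                (Scoped obj (length Γ) M × Scoped fam (length Γ) τ) × ScopedEnv Σ Γ
    scope-obj (O-Const c m) with scope-ctx c
    ... | hΣ , hΓ = (scoped (λ _ → refl) , scoped-mono (lookupAll hΣ m)) , hΣ , hΓ
    scope-obj (O-Var c p) with scope-ctx c
    ... | hΣ , hΓ with scoped-lookup p hΓ
    ... | lt , hτ = (scoped-var lt , hτ) , hΣ , hΓ
    scope-obj (O-Abs d) with scope-obj d
    ... | (hM , hτ) , hΣ , (hσ , hΓ) = (scoped-OLam hσ hM , scoped-FΠ hσ hτ) , hΣ , hΓ
    scope-obj (O-App d e) with scope-obj d | scope-obj e
    ... | (hM , hΠ) , env | (hN , _) , _ = (scoped-OApp hM hN , scoped-inst (body-FΠ hΠ) hN) , env
    scope-obj (O-Conv d f _) with scope-obj d | scope-fam f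
    ... | (hM , _) , env | (hτ , _) , _ = (hM , hτ) , env
    scope-obj (O-Lock d e) with scope-obj d | scope-obj e
    ... | (hM , hρ) , env | (hN , hσ) , _ = (scoped-OLock hN hσ hM , scoped-FLock hN hσ hρ) , env
    scope-obj (O-Top-Unlock d _) with scope-obj d
    ... | (hM , hT) , env with inv-FLock hT
    ... | hN , hσ , hρ = (scoped-OUnlock hN hσ hM , hρ) , env
    scope-obj (O-Guarded-Unlock d e _ _) with scope-obj d | scope-obj e
    ... | (hL , hT) , hΣ , (_ , hΓ) | (hN , hT') , _
        with inv-OLock hL | inv-FLock hT | inv-FLock hT'
    ... | hwS , hwσ , hM | _ , _ , hρ | hS' , hσ' , _ =
      let hS = scoped-unwk hwS ; hσ = scoped-unwk hwσ ; hU = scoped-OUnlock hS' hσ' hN in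
      (scoped-OLock hS hσ (scoped-inst (scoped-body hM) hU) ,
       scoped-FLock hS hσ (scoped-inst (scoped-body hρ) hU)) , hΣ , hΓ

  -- every prefix of the context of a derivable judgement is valid; this
  -- telescope form makes the extraction structurally recursive
  ValidTele : Sig 𝒫 → Ctx 𝒫 → Set
  ValidTele Σ []      = SigOK holds Σ
  ValidTele Σ (σ ∷ Γ) = FamOK holds Σ Γ σ KType × ValidTele Σ Γ

  mutual
    tele-ctx : ∀ {Σ Γ} → CtxOK holds Σ Γ → ValidTele Σ Γ
    tele-ctx (C-Empty s) = s
    tele-ctx (C-Ext d)   = d , tele-fam d

    tele-fam : ∀ {Σ Γ σ K} → FamOK holds Σ Γ σ K → ValidTele Σ Γ
    tele-fam (F-Const c _)              = tele-ctx c
    tele-fam (F-Pi d)                   = proj₂ (tele-fam d)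
    tele-fam (F-App d _)                = tele-fam d
    tele-fam (F-Lock d _)               = tele-fam d
    tele-fam (F-Conv d _ _)             = tele-fam d
    tele-fam (F-Guarded-Unlock _ d _ _) = tele-obj d

    tele-obj : ∀ {Σ Γ M τ} → ObjOK holds Σ Γ M τ → ValidTele Σ Γ
    tele-obj (O-Const c _)              = tele-ctx c
    tele-obj (O-Var c _)                = tele-ctx c
    tele-obj (O-Abs d)                  = proj₂ (tele-obj d)
    tele-obj (O-App d _)                = tele-obj d
    tele-obj (O-Conv d _ _)             = tele-obj d
    tele-obj (O-Lock d _)               = tele-obj d
    tele-obj (O-Top-Unlock d _)         = tele-obj d
    tele-obj (O-Guarded-Unlock _ d _ _) = tele-obj d

  tele-valid : ∀ {Σ Γ} → ValidTele Σ Γ → CtxOK holds Σ Γ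
  tele-valid {Γ = []}    s       = C-Empty s
  tele-valid {Γ = σ ∷ Γ} (d , _) = C-Ext d

  obj-ctx : ∀ {Σ Γ M τ} → ObjOK holds Σ Γ M τ → CtxOK holds Σ Γ
  obj-ctx = tele-valid ∘ tele-obj

  ctx-tail : ∀ {Σ Γ σ} → CtxOK holds Σ (σ ∷ Γ) → CtxOK holds Σ Γ
  ctx-tail = tele-valid ∘ proj₂ ∘ tele-ctx

  decl-scoped : ∀ {Σ Γ δ} → CtxOK holds Σ Γ → δ ∈ Σ → ScopedDecl δ
  decl-scoped c = lookupAll (proj₁ (scope-ctx c))

  skip : ℕ → Ren
  skip zero    = suc
  skip (suc k) = ext (skip k)

  skip-injective : ∀ k → Injective _≡_ _≡_ (skip k)
  skip-injective zero    eq = suc-injective eq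
  skip-injective (suc k) {zero}  {zero}  eq = refl
  skip-injective (suc k) {suc x} {suc y} eq = cong suc (skip-injective k (suc-injective eq))

  skipCtx : Ctx 𝒫 → Ctx 𝒫
  skipCtx []      = []
  skipCtx (σ ∷ Γ) = renF (skip (length Γ)) σ ∷ skipCtx Γ

  skip-lookup : ∀ Γ₂ {Γ₁ τ' i τ} → (Γ₂ ++ Γ₁) ∋ i ∶ τ →
                (skipCtx Γ₂ ++ τ' ∷ Γ₁) ∋ skip (length Γ₂) i ∶ renF (skip (length Γ₂)) τ
  skip-lookup []       p = there p
  skip-lookup (σ ∷ Γ₂) {Γ₁} {τ'} here =
    subst ((skipCtx (σ ∷ Γ₂) ++ τ' ∷ Γ₁) ∋ 0 ∶_) (sym (ren-wk fam (skip (length Γ₂)) σ)) here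
  skip-lookup (σ ∷ Γ₂) {Γ₁} {τ'} (there {σ = τ} {i = i} p) =
    subst ((skipCtx (σ ∷ Γ₂) ++ τ' ∷ Γ₁) ∋ suc (skip (length Γ₂) i) ∶_)
          (sym (ren-wk fam (skip (length Γ₂)) τ)) (there (skip-lookup Γ₂ p))

  -- The O-Top-Unlock case uses closure of the predicates under weakening; in
  -- the guarded unlocks the weakened S and σ of the premise are commuted with
  -- the renaming by ren-wk, and the instantiation of ρ by ren-β.
  module Weakening (weak-closed : CtxWeakClosed holds) {Σ : Sig 𝒫} {τ' : Fam 𝒫} {Γ₁ : Ctx 𝒫}
                   (valid : CtxOK holds Σ (τ' ∷ Γ₁)) where

    Wk : Ctx 𝒫 → Ctx 𝒫
    Wk Γ₂ = skipCtx Γ₂ ++ τ' ∷ Γ₁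

    mutual
      wk-ctx : ∀ Γ₂ → CtxOK holds Σ (Γ₂ ++ Γ₁) → CtxOK holds Σ (Wk Γ₂)
      wk-ctx []       c         = valid
      wk-ctx (σ ∷ Γ₂) (C-Ext d) = C-Ext (wk-fam Γ₂ d)

      wk-kind : ∀ Γ₂ {K} → KindOK holds Σ (Γ₂ ++ Γ₁) K →
                KindOK holds Σ (Wk Γ₂) (renK (skip (length Γ₂)) K)
      wk-kind Γ₂ (K-Type c)       = K-Type (wk-ctx Γ₂ c)
      wk-kind Γ₂ (K-Pi {σ = σ} d) = K-Pi (wk-kind (σ ∷ Γ₂) d)

      wk-fam : ∀ Γ₂ {σ K} → FamOK holds Σ (Γ₂ ++ Γ₁) σ K →
               FamOK holds Σ (Wk Γ₂) (renF (skip (length Γ₂)) σ) (renK (skip (length Γ₂)) K)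
      wk-fam Γ₂ (F-Const c m) =
        subst (FamOK holds Σ _ _) (sym (closed-ren (decl-scoped c m) _)) (F-Const (wk-ctx Γ₂ c) m)
      wk-fam Γ₂ (F-Pi {σ = σ} d) = F-Pi (wk-fam (σ ∷ Γ₂) d)
      wk-fam Γ₂ (F-App {K = K} {N = N} d e) =
        subst (FamOK holds Σ _ _) (sym (ren-β kind _ N K)) (F-App (wk-fam Γ₂ d) (wk-obj Γ₂ e))
      wk-fam Γ₂ (F-Lock d e) = F-Lock (wk-fam Γ₂ d) (wk-obj Γ₂ e)
      wk-fam Γ₂ (F-Conv d k e) = F-Conv (wk-fam Γ₂ d) (wk-kind Γ₂ k) (conv-ren kind _ e)
      wk-fam Γ₂ (F-Guarded-Unlock {S = S} {σ = σ} {ρ = ρ} {τ = τ} d e e₁ e₂) =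
        subst (λ x → FamOK holds Σ _ (FLock _ _ _ x) KType) (sym (ren-β fam _ _ ρ))
          (F-Guarded-Unlock
            (subst (λ x → FamOK holds Σ (Wk (τ ∷ Γ₂)) x KType)
                   (cong₂ (λ x y → FLock _ x y _) (ren-wk obj _ S) (ren-wk fam _ σ))
                   (wk-fam (τ ∷ Γ₂) d))
            (wk-obj Γ₂ e) (conv-ren fam _ e₁) (conv-ren obj _ e₂))

      wk-obj : ∀ Γ₂ {M τ} → ObjOK holds Σ (Γ₂ ++ Γ₁) M τ →
               ObjOK holds Σ (Wk Γ₂) (renO (skip (length Γ₂)) M) (renF (skip (length Γ₂)) τ)
      wk-obj Γ₂ (O-Const c m) =
        subst (ObjOK holds Σ _ _) (sym (closed-ren (decl-scoped c m) _)) (O-Const (wk-ctx Γ₂ c) m)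
      wk-obj Γ₂ (O-Var c p) = O-Var (wk-ctx Γ₂ c) (skip-lookup Γ₂ p)
      wk-obj Γ₂ (O-Abs {σ = σ} d) = O-Abs (wk-obj (σ ∷ Γ₂) d)
      wk-obj Γ₂ (O-App {N = N} {τ = τ} d e) =
        subst (ObjOK holds Σ _ _) (sym (ren-β fam _ N τ)) (O-App (wk-obj Γ₂ d) (wk-obj Γ₂ e))
      wk-obj Γ₂ (O-Conv d f e) = O-Conv (wk-obj Γ₂ d) (wk-fam Γ₂ f) (conv-ren fam _ e)
      wk-obj Γ₂ (O-Lock d e) = O-Lock (wk-obj Γ₂ d) (wk-obj Γ₂ e)
      wk-obj Γ₂ (O-Top-Unlock d h) =
        O-Top-Unlock (wk-obj Γ₂ d)
          (weak-closed (skip (length Γ₂)) (obj-ctx d) (obj-ctx (wk-obj Γ₂ d))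
                       (skip-injective (length Γ₂)) (skip-lookup Γ₂) h)
      wk-obj Γ₂ (O-Guarded-Unlock {S = S} {σ = σ} {M = M} {ρ = ρ} {τ = τ} d e e₁ e₂) =
        subst₂ (λ x y → ObjOK holds Σ _ (OLock _ _ _ x) (FLock _ _ _ y))
               (sym (ren-β obj _ _ M)) (sym (ren-β fam _ _ ρ))
          (O-Guarded-Unlock
            (subst₂ (ObjOK holds Σ (Wk (τ ∷ Γ₂)))
                    (cong₂ (λ x y → OLock _ x y _) (ren-wk obj _ S) (ren-wk fam _ σ))
                    (cong₂ (λ x y → FLock _ x y _) (ren-wk obj _ S) (ren-wk fam _ σ))
                    (wk-obj (τ ∷ Γ₂) d))
            (wk-obj Γ₂ e) (conv-ren fam _ e₁) (conv-ren obj _ e₂))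

  weaken : CtxWeakClosed holds → ∀ {Σ τ' Γ M τ} → CtxOK holds Σ (τ' ∷ Γ) → ObjOK holds Σ Γ M τ →
           ObjOK holds Σ (τ' ∷ Γ) (wkO M) (wkF τ)
  weaken weak-closed valid = Weakening.wk-obj weak-closed valid []

  -- Constants are unaffected since their types are closed;
  -- O-Top-Unlock uses closure of the predicates under substitution; the other
  -- cases commute the substitution with [N/0] and weakening as in Weakening.
  module Substitution (weak-closed : CtxWeakClosed holds) (subst-closed : SubstClosed holds)
                      {Σ : Sig 𝒫} {σ₀ : Fam 𝒫} {Γ₀ : Ctx 𝒫} {N₀ : Obj 𝒫}
                      (typed : ObjOK holds Σ Γ₀ N₀ σ₀) where

    Sb : Ctx 𝒫 → Ctx 𝒫
    Sb Γ' = substCtx Γ' N₀ ++ Γ₀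

    sb : Ctx 𝒫 → Sub 𝒫
    sb Γ' = sub1 (length Γ') N₀

    sub-fresh : ∀ (τ : Fam 𝒫) → subF (sb []) (wkF τ) ≡ τ
    sub-fresh τ = trans (sub-ren fam (sb []) suc τ) (sub-id fam τ)

    -- the variable case: x itself becomes N₀, variables of Γ₀ are unchanged,
    -- and variables of Γ' are handled by induction on Γ' and weakening
    sub-var : ∀ Γ' {i τ} → CtxOK holds Σ (Sb Γ') → (Γ' ++ σ₀ ∷ Γ₀) ∋ i ∶ τ →
              ObjOK holds Σ (Sb Γ') (sb Γ' i) (subF (sb Γ') τ)
    sub-var []       c here                = subst (ObjOK holds Σ _ _) (sym (sub-fresh σ₀)) typed
    sub-var []       c (there {σ = τ} p)   = subst (ObjOK holds Σ _ _) (sym (sub-fresh τ)) (O-Var c p)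
    sub-var (ρ ∷ Γ') c here                =
      subst (ObjOK holds Σ _ _) (sym (sub-wk fam (sb Γ') ρ)) (O-Var c here)
    sub-var (ρ ∷ Γ') c (there {σ = τ} p)   =
      subst (ObjOK holds Σ _ _) (sym (sub-wk fam (sb Γ') τ))
            (weaken weak-closed c (sub-var Γ' (ctx-tail c) p))

    mutual
      sub-ctx : ∀ Γ' → CtxOK holds Σ (Γ' ++ σ₀ ∷ Γ₀) → CtxOK holds Σ (Sb Γ')
      sub-ctx []       c         = obj-ctx typed
      sub-ctx (σ ∷ Γ') (C-Ext d) = C-Ext (sub-fam Γ' d)

      sub-kind : ∀ Γ' {K} → KindOK holds Σ (Γ' ++ σ₀ ∷ Γ₀) K → KindOK holds Σ (Sb Γ') (subK (sb Γ') K)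
      sub-kind Γ' (K-Type c)       = K-Type (sub-ctx Γ' c)
      sub-kind Γ' (K-Pi {σ = σ} d) = K-Pi (sub-kind (σ ∷ Γ') d)

      sub-fam : ∀ Γ' {σ K} → FamOK holds Σ (Γ' ++ σ₀ ∷ Γ₀) σ K →
                FamOK holds Σ (Sb Γ') (subF (sb Γ') σ) (subK (sb Γ') K)
      sub-fam Γ' (F-Const c m) =
        subst (FamOK holds Σ _ _) (sym (closed-sub (decl-scoped c m) _)) (F-Const (sub-ctx Γ' c) m)
      sub-fam Γ' (F-Pi {σ = σ} d) = F-Pi (sub-fam (σ ∷ Γ') d)
      sub-fam Γ' (F-App {K = K} {N = N} d e) =
        subst (FamOK holds Σ _ _) (sym (sub-β kind _ N K)) (F-App (sub-fam Γ' d) (sub-obj Γ' e))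
      sub-fam Γ' (F-Lock d e) = F-Lock (sub-fam Γ' d) (sub-obj Γ' e)
      sub-fam Γ' (F-Conv d k e) = F-Conv (sub-fam Γ' d) (sub-kind Γ' k) (conv-sub kind _ e)
      sub-fam Γ' (F-Guarded-Unlock {S = S} {σ = σ} {ρ = ρ} {τ = τ} d e e₁ e₂) =
        subst (λ x → FamOK holds Σ _ (FLock _ _ _ x) KType) (sym (sub-β fam _ _ ρ))
          (F-Guarded-Unlock
            (subst (λ x → FamOK holds Σ (Sb (τ ∷ Γ')) x KType)
                   (cong₂ (λ x y → FLock _ x y _) (sub-wk obj _ S) (sub-wk fam _ σ))
                   (sub-fam (τ ∷ Γ') d))
            (sub-obj Γ' e) (conv-sub fam _ e₁) (conv-sub obj _ e₂))

      sub-obj : ∀ Γ' {M τ} → ObjOK holds Σ (Γ' ++ σ₀ ∷ Γ₀) M τ →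
                ObjOK holds Σ (Sb Γ') (subO (sb Γ') M) (subF (sb Γ') τ)
      sub-obj Γ' (O-Const c m) =
        subst (ObjOK holds Σ _ _) (sym (closed-sub (decl-scoped c m) _)) (O-Const (sub-ctx Γ' c) m)
      sub-obj Γ' (O-Var c p) = sub-var Γ' (sub-ctx Γ' c) p
      sub-obj Γ' (O-Abs {σ = σ} d) = O-Abs (sub-obj (σ ∷ Γ') d)
      sub-obj Γ' (O-App {N = N} {τ = τ} d e) =
        subst (ObjOK holds Σ _ _) (sym (sub-β fam _ N τ)) (O-App (sub-obj Γ' d) (sub-obj Γ' e))
      sub-obj Γ' (O-Conv d f e) = O-Conv (sub-obj Γ' d) (sub-fam Γ' f) (conv-sub fam _ e)
      sub-obj Γ' (O-Lock d e) = O-Lock (sub-obj Γ' d) (sub-obj Γ' e)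
      sub-obj Γ' (O-Top-Unlock d h) = O-Top-Unlock (sub-obj Γ' d) (subst-closed h typed)
      sub-obj Γ' (O-Guarded-Unlock {S = S} {σ = σ} {M = M} {ρ = ρ} {τ = τ} d e e₁ e₂) =
        subst₂ (λ x y → ObjOK holds Σ _ (OLock _ _ _ x) (FLock _ _ _ y))
               (sym (sub-β obj _ _ M)) (sym (sub-β fam _ _ ρ))
          (O-Guarded-Unlock
            (subst₂ (ObjOK holds Σ (Sb (τ ∷ Γ')))
                    (cong₂ (λ x y → OLock _ x y _) (sub-wk obj _ S) (sub-wk fam _ σ))
                    (cong₂ (λ x y → FLock _ x y _) (sub-wk obj _ S) (sub-wk fam _ σ))
                    (sub-obj (τ ∷ Γ') d))
            (sub-obj Γ' e) (conv-sub fam _ e₁) (conv-sub obj _ e₂))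

proposition4p5 : {𝒫 : Set} (holds : Holds 𝒫) →
    SigWeakClosed holds → CtxWeakClosed holds → SubstClosed holds →
    ∀ {Σ Γ Γ' σ N} → ObjOK holds Σ Γ N σ →
      (∀ {K} → KindOK holds Σ (Γ' ++ σ ∷ Γ) K →
         KindOK holds Σ (substCtx Γ' N ++ Γ) (K [ N / length Γ' ]K))
    × (∀ {τ K} → FamOK holds Σ (Γ' ++ σ ∷ Γ) τ K →
         FamOK holds Σ (substCtx Γ' N ++ Γ) (τ [ N / length Γ' ]F) (K [ N / length Γ' ]K))
    × (∀ {M τ} → ObjOK holds Σ (Γ' ++ σ ∷ Γ) M τ →
         ObjOK holds Σ (substCtx Γ' N ++ Γ) (M [ N / length Γ' ]O) (τ [ N / length Γ' ]F))
proposition4p5 holds _ weak-closed subst-closed {Γ' = Γ'} typed =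
  sub-kind Γ' , sub-fam Γ' , sub-obj Γ'
  where open Structure.Substitution holds weak-closed subst-closed typed
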